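{- Let $G=\langle N,E,l\rangle$ be a tree with root $r$, let $m,n\in N$ and $k\ge 0$. Then $n$ and $m$ are backward $k$-bisimilar if and only if $T_n^{k+1}=T_m^{k+1}$.
   Context: $G=\langle N,E,l\rangle$ is a rooted tree with edges directed from parent to child and $l$ a labeling function on nodes; $\mathrm{parents}(n)$ is the set of nodes $p$ with $(p,n)\in E$. Backward $k$-bisimilarity $\approx^k$ is defined inductively: $n\approx^0 m$ iff $l(n)=l(m)$; for $k>0$, $n\approx^k m$ iff (1) $n\approx^{k-1}m$, (2) for each $n'\in\mathrm{parents}(n)$ there is $m'\in\mathrm{parents}(m)$ with $n'\approx^{k-1}m'$, and (3) for each $m'\in\mathrm{parents}(m)$ there is $n'\in\mathrm{parents}(n)$ with $n'\approx^{k-1}m'$. For $n\in N$, let $L(r,n)=\langle l(r),\dots,l(n)\rangle$ be the sequence of labels of the nodes on the path from $r$ to $n$ (including both endpoints). For $k\ge 0$, the $k$-trace $T_n^k$ is the sequence of the last $k$ elements of $L(r,n)$; if $k>|L(r,n)|$, it is $L(r,n)$ prefixed by $k-|L(r,n)|$ copies of a reserved label $\lambda$ not in the range of $l$. -}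

module Defs where

open import Data.Nat using (ℕ; zero; suc; _∸_)
open import Data.List using (List; []; _∷_; _++_; [_]; map; drop; replicate; length)
open import Data.Maybe using (Maybe; just; nothing)
open import Data.Product using (_×_; ∃-syntax)
open import Relation.Binary.PropositionalEquality using (_≡_)

data RootPath {N : Set} (E : N → N → Set) (r : N) : N → Set where
  here : RootPath E r r
  step : ∀ {p n} → RootPath E r p → E p n → RootPath E r n

-- Edges are directed parent → child.  "Tree with root r" is encoded as:
-- every node n has exactly one directed path from r to n.
record RootedTree (Label : Set) : Set₁ where
  field
    Node  : Set
    Edge  : Node → Node → Set
    label : Node → Label
    root  : Node
    path        : (n : Node) → RootPath Edge root n
    path-unique : ∀ {n} (q : RootPath Edge root n) → q ≡ path n

open RootedTree public

module _ {Label : Set} (G : RootedTree Label) where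

  pathLabels : ∀ {n} → RootPath (Edge G) (root G) n → List Label
  pathLabels {n} (here)     = [ label G n ]
  pathLabels {n} (step q e) = pathLabels q ++ [ label G n ]

  L : Node G → List Label
  L n = pathLabels (path G n)

  -- k-trace T_n^k; the reserved label λ is `nothing`, real labels are `just a`
  trace : ℕ → Node G → List (Maybe Label)
  trace k n =
    replicate (k ∸ length (L n)) nothing
      ++ map just (drop (length (L n) ∸ k) (L n))

  Bisim : ℕ → Node G → Node G → Set
  Bisim zero    n m = label G n ≡ label G m
  Bisim (suc k) n m =
    Bisim k n m
    × (∀ n' → Edge G n' n → ∃[ m' ] (Edge G m' m × Bisim k n' m'))
    × (∀ m' → Edge G m' m → ∃[ n' ] (Edge G n' n × Bisim k n' m'))

-- Read from n back to the root, the (k+1)-trace of n is l(n) followed by the k-trace of its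
-- parent (or by k copies of λ at the root).  In a tree each node has at most one parent, so the
-- back-and-forth clauses of ≈^(k+1) say exactly that the parents are ≈^k-related, and induction
-- on k matches the two descriptions clause by clause.
module Submission where

open import Defs
open import Data.Nat using (ℕ; zero; suc; _∸_; _≤_; s≤s)
open import Data.Nat.Properties using (m∸n≤m; +-comm)
open import Data.List
  using (List; []; _∷_; _++_; _∷ʳ_; [_]; map; drop; replicate; length; reverse)
open import Data.List.Properties
  using (map-++; ++-assoc; ++-identityʳ; length-++; unfold-reverse; reverse-injective;
         drop-all; drop-[]; ∷-injective)
open import Data.Maybe using (Maybe; just; nothing)
open import Data.Maybe.Properties using (just-injective)
open import Data.Product using (_×_; _,_; proj₁; ∃-syntax)
open import Data.Empty using (⊥-elim)
open import Function.Bundles using (_⇔_; mk⇔; module Equivalence)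
open import Function.Construct.Composition using (_⇔-∘_)
open import Relation.Nullary using (¬_)
open import Relation.Binary.PropositionalEquality
  using (_≡_; refl; sym; trans; cong; cong₂; subst; subst₂; module ≡-Reasoning)

open Equivalence

module _ {A : Set} where

  lastPadded : ℕ → List A → List (Maybe A)
  lastPadded k xs = replicate (k ∸ length xs) nothing ++ map just (drop (length xs ∸ k) xs)

  takePadded : ℕ → List A → List (Maybe A)
  takePadded zero    _        = []
  takePadded (suc k) []       = nothing ∷ takePadded k []
  takePadded (suc k) (x ∷ xs) = just x ∷ takePadded k xs

  takePadded-pred : ∀ k {xs ys : List A} →
    takePadded (suc k) xs ≡ takePadded (suc k) ys → takePadded k xs ≡ takePadded k ys
  takePadded-pred zero    _ = refl
  takePadded-pred (suc k) {[]}     {[]}     _ = refl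
  takePadded-pred (suc k) {x ∷ xs} {y ∷ ys} eq
    with hd , tl ← ∷-injective eq = cong₂ _∷_ hd (takePadded-pred k tl)

  ∷-takePadded-≡ : ∀ k {x y : A} {xs ys} →
    (x ≡ y × takePadded k xs ≡ takePadded k ys) ⇔
    takePadded (suc k) (x ∷ xs) ≡ takePadded (suc k) (y ∷ ys)
  ∷-takePadded-≡ k = mk⇔
    (λ (hd , tl) → cong₂ _∷_ (cong just hd) tl)
    (λ eq → let hd , tl = ∷-injective eq in just-injective hd , tl)

  drop-++ˡ : ∀ d (xs ys : List A) → d ≤ length xs → drop d (xs ++ ys) ≡ drop d xs ++ ys
  drop-++ˡ zero    xs       ys _       = refl
  drop-++ˡ (suc d) (x ∷ xs) ys (s≤s p) = drop-++ˡ d xs ys p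

  replicate-∷ʳ : ∀ {B : Set} k (x : B) → replicate k x ∷ʳ x ≡ x ∷ replicate k x
  replicate-∷ʳ zero    x = refl
  replicate-∷ʳ (suc k) x = cong (x ∷_) (replicate-∷ʳ k x)

  lastPadded-∷ʳ : ∀ k (xs : List A) x → lastPadded (suc k) (xs ∷ʳ x) ≡ lastPadded k xs ∷ʳ just x
  lastPadded-∷ʳ k xs x = begin
      lastPadded (suc k) (xs ∷ʳ x)
    ≡⟨ cong (λ l → replicate (suc k ∸ l) nothing ++ map just (drop (l ∸ suc k) (xs ∷ʳ x)))
            length-∷ʳ ⟩
      pad ++ map just (drop (length xs ∸ k) (xs ∷ʳ x))
    ≡⟨ cong (λ t → pad ++ map just t) (drop-++ˡ (length xs ∸ k) xs [ x ] (m∸n≤m _ k)) ⟩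
      pad ++ map just (drop (length xs ∸ k) xs ∷ʳ x)
    ≡⟨ cong (pad ++_) (map-++ just (drop (length xs ∸ k) xs) [ x ]) ⟩
      pad ++ (map just (drop (length xs ∸ k) xs) ∷ʳ just x)
    ≡⟨ sym (++-assoc pad _ _) ⟩
      lastPadded k xs ∷ʳ just x
    ∎
    where
      open ≡-Reasoning
      pad : List (Maybe A)
      pad = replicate (k ∸ length xs) nothing
      length-∷ʳ : length (xs ∷ʳ x) ≡ suc (length xs)
      length-∷ʳ = trans (length-++ xs) (+-comm (length xs) 1)

  reverse-takePadded-[] : ∀ k → reverse (takePadded k []) ≡ replicate k nothing
  reverse-takePadded-[] zero    = refl
  reverse-takePadded-[] (suc k) = begin
      reverse (takePadded (suc k) [])        ≡⟨ unfold-reverse nothing (takePadded k []) ⟩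
      reverse (takePadded k []) ∷ʳ nothing   ≡⟨ cong (_∷ʳ nothing) (reverse-takePadded-[] k) ⟩
      replicate k nothing ∷ʳ nothing         ≡⟨ replicate-∷ʳ k nothing ⟩
      replicate (suc k) nothing              ∎
    where open ≡-Reasoning

  lastPadded-zero : ∀ (xs : List A) → lastPadded zero xs ≡ []
  lastPadded-zero []       = refl
  lastPadded-zero (x ∷ xs) = cong (map just) (drop-all (length xs) xs (m∸n≤m _ 0))

  lastPadded-reverse : ∀ k (ys : List A) → lastPadded k (reverse ys) ≡ reverse (takePadded k ys)
  lastPadded-reverse k       []       = begin
      replicate k nothing ++ map just (drop (0 ∸ k) [])
    ≡⟨ cong (λ t → replicate k nothing ++ map just t) (drop-[] (0 ∸ k)) ⟩
      replicate k nothing ++ []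
    ≡⟨ ++-identityʳ _ ⟩
      replicate k nothing
    ≡⟨ sym (reverse-takePadded-[] k) ⟩
      reverse (takePadded k [])
    ∎
    where open ≡-Reasoning
  lastPadded-reverse zero    (y ∷ ys) = lastPadded-zero (reverse (y ∷ ys))
  lastPadded-reverse (suc k) (y ∷ ys) = begin
      lastPadded (suc k) (reverse (y ∷ ys))   ≡⟨ cong (lastPadded (suc k)) (unfold-reverse y ys) ⟩
      lastPadded (suc k) (reverse ys ∷ʳ y)    ≡⟨ lastPadded-∷ʳ k (reverse ys) y ⟩
      lastPadded k (reverse ys) ∷ʳ just y     ≡⟨ cong (_∷ʳ just y) (lastPadded-reverse k ys) ⟩
      reverse (takePadded k ys) ∷ʳ just y     ≡⟨ sym (unfold-reverse (just y) (takePadded k ys)) ⟩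
      reverse (takePadded (suc k) (y ∷ ys))   ∎
    where open ≡-Reasoning

reverse-≡ : ∀ {A : Set} {xs ys : List A} → xs ≡ ys ⇔ reverse xs ≡ reverse ys
reverse-≡ = mk⇔ (cong reverse) reverse-injective

module _ {Label : Set} (G : RootedTree Label) where

  private
    RootPathTo : Node G → Set
    RootPathTo = RootPath (Edge G) (root G)

  ancestorLabels : ∀ {n} → RootPathTo n → List Label
  ancestorLabels here                = []
  ancestorLabels (step {p = p} q _) = label G p ∷ ancestorLabels q

  pathLabels-ancestorLabels : ∀ {n} (q : RootPathTo n) →
    pathLabels G q ≡ reverse (label G n ∷ ancestorLabels q)
  pathLabels-ancestorLabels here = refl
  pathLabels-ancestorLabels {n} (step {p = p} q _) = begin
      pathLabels G q ∷ʳ label G n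
    ≡⟨ cong (_∷ʳ label G n) (pathLabels-ancestorLabels q) ⟩
      reverse (label G p ∷ ancestorLabels q) ∷ʳ label G n
    ≡⟨ sym (unfold-reverse (label G n) (label G p ∷ ancestorLabels q)) ⟩
      reverse (label G n ∷ label G p ∷ ancestorLabels q)
    ∎
    where open ≡-Reasoning

  trace-ancestorLabels : ∀ k n →
    trace G k n ≡ reverse (takePadded k (label G n ∷ ancestorLabels (path G n)))
  trace-ancestorLabels k n =
    trans (cong (lastPadded k) (pathLabels-ancestorLabels (path G n))) (lastPadded-reverse k _)

  private
    step-injective : ∀ {p q n} {qp : RootPathTo p} {qq : RootPathTo q}
      {ep : Edge G p n} {eq : Edge G q n} → step qp ep ≡ step qq eq → p ≡ q
    step-injective refl = refl

  parent-unique : ∀ {p q n} → Edge G p n → Edge G q n → p ≡ q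
  parent-unique ep eq = step-injective
    (trans (path-unique G (step (path G _) ep)) (sym (path-unique G (step (path G _) eq))))

  root-parentless : ∀ {p} → ¬ Edge G p (root G)
  root-parentless ep with () ← trans (path-unique G (step (path G _) ep)) (sym (path-unique G here))

  Bisim-parents⇔ : ∀ k {p q n m} → Edge G p n → Edge G q m →
    Bisim G k p q ⇔
    ((∀ n' → Edge G n' n → ∃[ m' ] (Edge G m' m × Bisim G k n' m')) ×
     (∀ m' → Edge G m' m → ∃[ n' ] (Edge G n' n × Bisim G k n' m')))
  Bisim-parents⇔ k {p} {q} ep eq = mk⇔
    (λ b → (λ n' en' → q , eq , subst (λ x → Bisim G k x q) (parent-unique ep en') b)
         , (λ m' em' → p , ep , subst (Bisim G k p) (parent-unique eq em') b))
    (λ (forth , _) → matched-parent (forth p ep))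
    where
      matched-parent : ∃[ m' ] (Edge G m' _ × Bisim G k p m') → Bisim G k p q
      matched-parent (m' , em' , b) = subst (Bisim G k p) (parent-unique em' eq) b

  Bisim⇔ancestorLabels : ∀ k {n m} (qn : RootPathTo n) (qm : RootPathTo m) →
    Bisim G k n m ⇔
    (label G n ≡ label G m × takePadded k (ancestorLabels qn) ≡ takePadded k (ancestorLabels qm))
  Bisim⇔ancestorLabels zero    _ _ = mk⇔ (_, refl) (λ (l , _) → l)
  Bisim⇔ancestorLabels (suc k) here here = mk⇔
    (λ _ → refl , refl)
    (λ _ → from (Bisim⇔ancestorLabels k here here) (refl , refl)
         , (λ _ e → ⊥-elim (root-parentless e))
         , (λ _ e → ⊥-elim (root-parentless e)))
  Bisim⇔ancestorLabels (suc k) here (step _ e) = mk⇔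
    (λ (_ , _ , back) → let _ , e' , _ = back _ e in ⊥-elim (root-parentless e'))
    (λ ())
  Bisim⇔ancestorLabels (suc k) (step _ e) here = mk⇔
    (λ (_ , forth , _) → let _ , e' , _ = forth _ e in ⊥-elim (root-parentless e'))
    (λ ())
  Bisim⇔ancestorLabels (suc k) (step qp ep) (step qq eq) = mk⇔
    (λ (b , parents) → proj₁ (to (Bisim⇔ancestorLabels k (step qp ep) (step qq eq)) b)
      , to (∷-takePadded-≡ k)
           (to (Bisim⇔ancestorLabels k qp qq) (from (Bisim-parents⇔ k ep eq) parents)))
    (λ (l , h) → from (Bisim⇔ancestorLabels k (step qp ep) (step qq eq)) (l , takePadded-pred k h)
      , to (Bisim-parents⇔ k ep eq)
           (from (Bisim⇔ancestorLabels k qp qq) (from (∷-takePadded-≡ k) h)))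

proposition1 : {Label : Set} (G : RootedTree Label) (m n : Node G) (k : ℕ) →
    Bisim G k n m ⇔ (trace G (suc k) n ≡ trace G (suc k) m)
proposition1 G m n k =
  subst₂ (λ s t → Bisim G k n m ⇔ (s ≡ t))
    (sym (trace-ancestorLabels G (suc k) n)) (sym (trace-ancestorLabels G (suc k) m))
    (reverse-≡ ⇔-∘ (∷-takePadded-≡ k ⇔-∘ Bisim⇔ancestorLabels G k (path G n) (path G m)))
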